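{- Let $n\ge 0$ be an integer and let $G$ be a connected graph with exactly $n$ edges. Then \[\mathrm{copsi}(G)\le \mathrm{copsi}(\mathsf{K}_{1,n}),\] and if $\mathrm{copsi}(G)=\mathrm{copsi}(\mathsf{K}_{1,n})$, then $G$ is isomorphic to $\mathsf{K}_{1,n}$.
   Context: A graph is a set of vertices together with a set of two-element subsets of it (edges); the size of a graph is its number of edges and its order is its number of vertices. A partial symmetry of a graph $G$ is a triple $(U,V,f)$ where $U$ and $V$ are induced subgraphs of $G$ and $f\colon U\to V$ is a graph isomorphism. It is a connected partial symmetry if $U$ (equivalently $V$) is non-empty and connected. The connected partial symmetry index $\mathrm{copsi}(G)$ is the number of connected partial symmetries of $G$. $\mathsf{K}_{1,n}$ denotes the star with $n$ rays, i.e. the complete bipartite graph with one vertex adjacent to each of $n$ other vertices (and no other edges). -}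

module Defs where

open import Data.Nat using (ℕ; zero; suc; _≤_; _<_)
open import Data.Fin using (Fin; toℕ) renaming (zero to fz; suc to fs)
open import Data.Bool using (Bool; true; false)
open import Data.Maybe using (Maybe; just; nothing)
open import Data.Vec using (Vec; lookup)
open import Data.List using (List; length)
open import Data.List.Membership.Propositional using (_∈_)
open import Data.List.Relation.Unary.Unique.Propositional using (Unique)
open import Data.Product using (Σ; ∃; _×_; _,_)
open import Function.Bundles using (_↔_; _⇔_; Inverse)
open import Relation.Binary.PropositionalEquality using (_≡_)

record Graph : Set where
  field
    order : ℕ
    adj   : Fin order → Fin order → Bool
    sym   : ∀ i j → adj i j ≡ adj j i
    irr   : ∀ i → adj i i ≡ false
open Graph public

CountIs : {A : Set} → (A → Set) → ℕ → Set
CountIs {A} P k =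
  Σ (List A) λ xs → length xs ≡ k × Unique xs × (∀ a → P a ⇔ a ∈ xs)

-- Edges: unordered pairs {i,j}, represented canonically as (i,j) with i < j.
IsEdge : (G : Graph) → Fin (order G) × Fin (order G) → Set
IsEdge G (i , j) = (toℕ i < toℕ j) × (adj G i j ≡ true)

HasSize : Graph → ℕ → Set
HasSize G n = CountIs (IsEdge G) n

data Walk (G : Graph) (S : Fin (order G) → Set) : Fin (order G) → Fin (order G) → Set where
  here  : ∀ {u} → Walk G S u u
  there : ∀ {u w v} → adj G u w ≡ true → S w → Walk G S w v → Walk G S u v

ConnectedOn : (G : Graph) → (Fin (order G) → Set) → Set
ConnectedOn G S = (∃ λ i → S i) × (∀ i j → S i → S j → Walk G S i j)

Connected : Graph → Set
Connected G = ConnectedOn G (λ _ → Data.Unit.⊤)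
  where import Data.Unit

-- A partial map on vertices, encoded as a vector: entry i is just (f i) for
-- i ∈ U and nothing otherwise. U = domain, V = image.
PMap : Graph → Set
PMap G = Vec (Maybe (Fin (order G))) (order G)

Dom : (G : Graph) → PMap G → Fin (order G) → Set
Dom G p i = ∃ λ j → lookup p i ≡ just j

-- (U, V, f) is a partial symmetry: f injective on U and, for u,u' ∈ U,
-- u ~ u' iff f u ~ f u' (isomorphism of induced subgraphs G[U] ≅ G[f(U)]).
IsPartialSym : (G : Graph) → PMap G → Set
IsPartialSym G p =
  (∀ i j k → lookup p i ≡ just k → lookup p j ≡ just k → i ≡ j) ×
  (∀ i j i' j' → lookup p i ≡ just i' → lookup p j ≡ just j' →
     adj G i j ≡ adj G i' j')

IsConnPartialSym : (G : Graph) → PMap G → Set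
IsConnPartialSym G p = IsPartialSym G p × ConnectedOn G (Dom G p)

Copsi : Graph → ℕ → Set
Copsi G k = CountIs (IsConnPartialSym G) k

_≅_ : Graph → Graph → Set
G ≅ H = Σ (Fin (order G) ↔ Fin (order H)) λ φ →
  ∀ i j → adj G i j ≡ adj H (Inverse.to φ i) (Inverse.to φ j)

starAdj : (n : ℕ) → Fin (suc n) → Fin (suc n) → Bool
starAdj n fz     fz     = false
starAdj n fz     (fs _) = true
starAdj n (fs _) fz     = true
starAdj n (fs _) (fs _) = false

starSym : ∀ n i j → starAdj n i j ≡ starAdj n j i
starSym n fz     fz     = Relation.Binary.PropositionalEquality.refl
starSym n fz     (fs _) = Relation.Binary.PropositionalEquality.refl
starSym n (fs _) fz     = Relation.Binary.PropositionalEquality.refl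
starSym n (fs _) (fs _) = Relation.Binary.PropositionalEquality.refl

starIrr : ∀ n i → starAdj n i i ≡ false
starIrr n fz     = Relation.Binary.PropositionalEquality.refl
starIrr n (fs _) = Relation.Binary.PropositionalEquality.refl

Star : ℕ → Graph
Star n = record { order = suc n ; adj = starAdj n ; sym = starSym n ; irr = starIrr n }

-- A connected partial symmetry f of G is transported to the star K_{1,n} whose leaves are the
-- edges of G.  If dom f spans no edge, f is a single vertex u ↦ v and goes to ι u ↦ ι v, where ι
-- embeds the at most n + 1 vertices of the connected graph G into K_{1,n}.  If dom f spans exactly
-- one edge k, mapped onto j against the fixed orientation of edges, f goes to the symmetry sending
-- leaf k to the centre and the centre to leaf j.  Otherwise f goes to the symmetry fixing the
-- centre and acting on leaves as f acts on the edges spanned by dom f; connectedness of dom f lets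
-- one recover f from this action, so the transport is injective.  If the counts agree it is onto,
-- so for any edges i ≠ j some f acts on edges exactly as the identity on {i, j}: then i and j form
-- an induced path of length two.  Edges that pairwise meet without ever closing a triangle share a
-- vertex, so G is a star.

module Submission where

open import Defs hiding (sym)
open import Data.Bool using (Bool; true; false; not; _xor_)
open import Data.Bool.Properties using (not-involutive)
open import Data.Fin using (Fin; toℕ; inject≤) renaming (zero to fz; suc to fs)
open import Data.Fin.Properties
  using (any?; all?; ¬∀⟶∃¬; injective⇒≤; suc-injective; <-cmp; <-asym; inject≤-injective) renaming (_≟_ to _≟F_)
open import Data.List as List using (List; []; _∷_; length)
open import Data.List.Membership.Propositional using (_∈_; _∉_)
open import Data.List.Membership.Propositional.Properties using (∈-lookup)
open import Data.List.Relation.Unary.All as All using ([])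
open import Data.List.Relation.Unary.All.Properties using (¬Any⇒All¬)
open import Data.List.Relation.Unary.AllPairs using ([]; _∷_)
open import Data.List.Relation.Unary.Any as Any using (here; there; index)
open import Data.List.Relation.Unary.Any.Properties using (lookup-index)
open import Data.List.Relation.Unary.Unique.Propositional using (Unique)
open import Data.Maybe as Maybe using (Maybe; just; nothing)
open import Data.Maybe.Properties using (just-injective; map-injective) renaming (≡-dec to ≡-decMaybe)
open import Data.Nat as ℕ using (ℕ; zero; suc; _≤_; s≤s)
open import Data.Nat.Properties using (<-irrefl; <-trans; <⇒≱; n<1+n)
open import Data.Product using (Σ; ∃; ∃₂; _×_; _,_; proj₁; proj₂)
open import Data.Product.Properties using (,-injectiveˡ; ,-injectiveʳ)
open import Data.Sum as Sum using (_⊎_; inj₁; inj₂)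
open import Data.Unit using (tt)
open import Data.Vec using (Vec; _∷_; lookup; replicate; tabulate; _[_]≔_)
open import Data.Vec.Properties
  using (lookup∘tabulate; tabulate∘lookup; tabulate-cong; lookup∘update; lookup∘update′; lookup-replicate)
open import Function.Base using (_∘_)
open import Function.Bundles using (_⇔_; Equivalence; mk↔ₛ′)
open import Function.Definitions using (Injective)
open import Relation.Binary.Definitions using (DecidableEquality; tri<; tri≈; tri>)
open import Relation.Binary.PropositionalEquality
  using (_≡_; _≢_; refl; sym; trans; cong; cong₂; subst; module ≡-Reasoning)
open import Relation.Nullary using (¬_; Dec; yes; no; contradiction; ¬?; _×-dec_; _⊎-dec_)
import Relation.Nullary.Decidable as Dec
open import Relation.Unary using (Decidable)

-- Counting through injections

lookup-injective : ∀ {A : Set} {xs : List A} → Unique xs → Injective _≡_ _≡_ (List.lookup xs)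
lookup-injective {xs = _ ∷ _} _          {fz}   {fz}   _ = refl
lookup-injective {xs = _ ∷ _} (x∉xs ∷ _) {fz}   {fs j} e = contradiction e (All.lookup x∉xs (∈-lookup j))
lookup-injective {xs = _ ∷ _} (x∉xs ∷ _) {fs i} {fz}   e = contradiction (sym e) (All.lookup x∉xs (∈-lookup i))
lookup-injective {xs = _ ∷ _} (_ ∷ xs!)  {fs i} {fs j} e = cong fs (lookup-injective xs! e)

_∈?_ : ∀ {n} (i : Fin n) xs → Dec (i ∈ xs)
i ∈? xs = Any.any? (i ≟F_) xs

covers⇒≤length : ∀ {n} (xs : List (Fin n)) → (∀ i → i ∈ xs) → n ≤ length xs
covers⇒≤length xs covers = injective⇒≤ λ {i} {j} e →
  trans (lookup-index (covers i)) (trans (cong (List.lookup xs) e) (sym (lookup-index (covers j))))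

length<⇒∃∉ : ∀ {n} (xs : List (Fin n)) → length xs ℕ.< n → ∃ λ i → i ∉ xs
length<⇒∃∉ xs |xs|<n with any? (λ i → ¬? (i ∈? xs))
... | yes found = found
... | no  none  = contradiction (covers⇒≤length xs covers) (<⇒≱ |xs|<n)
  where
    covers : ∀ i → i ∈ xs
    covers i = Dec.decidable-stable (i ∈? xs) (λ i∉xs → none (i , i∉xs))

below-bounded⇒≤suc : ∀ {n b} → Fin n → (∀ k → k ℕ.< n → k ≤ b) → n ≤ suc b
below-bounded⇒≤suc {suc n} _ below = s≤s (below n (n<1+n n))

module _ {A B : Set} {P : A → Set} {Q : B → Set}
         (f : ∀ x → P x → B)
         (f-into : ∀ {x} (px : P x) → Q (f x px))
         (f-injective : ∀ {x y} (px : P x) (py : P y) → f x px ≡ f y py → x ≡ y) where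

  private
    module Enumerations (xs : List A) (xs! : Unique xs) (xs-P : ∀ x → P x ⇔ x ∈ xs)
                        (ys : List B) (ys-Q : ∀ y → Q y ⇔ y ∈ ys) where

      P-lookup : ∀ i → P (List.lookup xs i)
      P-lookup i = Equivalence.from (xs-P _) (∈-lookup i)

      position : ∀ {y} → Q y → Fin (length ys)
      position {y} qy = index (Equivalence.to (ys-Q y) qy)

      lookup-position : ∀ {y} (qy : Q y) → List.lookup ys (position qy) ≡ y
      lookup-position {y} qy = sym (lookup-index (Equivalence.to (ys-Q y) qy))

      encode : Fin (length xs) → Fin (length ys)
      encode i = position (f-into (P-lookup i))

      lookup-encode : ∀ i → List.lookup ys (encode i) ≡ f (List.lookup xs i) (P-lookup i)
      lookup-encode i = lookup-position (f-into (P-lookup i))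

      encode-injective : Injective _≡_ _≡_ encode
      encode-injective {i} {j} e = lookup-injective xs! (f-injective (P-lookup i) (P-lookup j) (begin
        f (List.lookup xs i) (P-lookup i)  ≡⟨ sym (lookup-encode i) ⟩
        List.lookup ys (encode i)          ≡⟨ cong (List.lookup ys) e ⟩
        List.lookup ys (encode j)          ≡⟨ lookup-encode j ⟩
        f (List.lookup xs j) (P-lookup j)  ∎))
        where open ≡-Reasoning

      encode-onto : length ys ≡ length xs → ∀ {y} (qy : Q y) → ∃ λ i → encode i ≡ position qy
      encode-onto |ys| qy with any? (λ i → encode i ≟F position qy)
      ... | yes found = found
      ... | no ∉image =
        contradiction (subst (suc (length xs) ≤_) |ys| (injective⇒≤ extended-injective)) (<-irrefl refl)
        where
          extended : Fin (suc (length xs)) → Fin (length ys)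
          extended fz     = position qy
          extended (fs i) = encode i
          extended-injective : Injective _≡_ _≡_ extended
          extended-injective {fz}   {fz}   _ = refl
          extended-injective {fz}   {fs j} e = contradiction (j , sym e) ∉image
          extended-injective {fs i} {fz}   e = contradiction (i , e) ∉image
          extended-injective {fs i} {fs j} e = cong fs (encode-injective e)

  count-injective⇒≤ : ∀ {a b} → CountIs P a → CountIs Q b → a ≤ b
  count-injective⇒≤ (xs , refl , xs! , xs-P) (ys , refl , _ , ys-Q) = injective⇒≤ encode-injective
    where open Enumerations xs xs! xs-P ys ys-Q

  count-injective⇒onto : ∀ {a} → CountIs P a → CountIs Q a →
                         ∀ {y} → Q y → ∃ λ x → Σ (P x) λ px → f x px ≡ y
  count-injective⇒onto (xs , refl , xs! , xs-P) (ys , |ys| , _ , ys-Q) qy =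
    let i , e = encode-onto |ys| qy in
    List.lookup xs i , P-lookup i , trans (sym (lookup-encode i)) (trans (cong (List.lookup ys) e) (lookup-position qy))
    where open Enumerations xs xs! xs-P ys ys-Q

_∶_↦_ : ∀ {A : Set} {n} → Vec (Maybe A) n → Fin n → A → Set
v ∶ i ↦ a = lookup v i ≡ just a

↦-functional : ∀ {A : Set} {n} (v : Vec (Maybe A) n) {i a b} → v ∶ i ↦ a → v ∶ i ↦ b → a ≡ b
↦-functional _ e e' = just-injective (trans (sym e) e')

single : ∀ {A : Set} n → Fin n → A → Vec (Maybe A) n
single n i a = replicate n nothing [ i ]≔ just a

single-↦ : ∀ {A : Set} {n} (i : Fin n) (a : A) → single n i a ∶ i ↦ a
single-↦ {n = n} i a = lookup∘update i (replicate n nothing) (just a)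

single-↦⁻ : ∀ {A : Set} {n} (i : Fin n) (a : A) {j b} → single n i a ∶ j ↦ b → j ≡ i × a ≡ b
single-↦⁻ {n = n} i a {j} e with j ≟F i
... | yes refl = refl , just-injective (trans (sym (single-↦ i a)) e)
... | no j≢i   = contradiction (begin
  nothing                                   ≡⟨ sym (lookup-replicate j nothing) ⟩
  lookup (replicate n nothing) j            ≡⟨ sym (lookup∘update′ j≢i (replicate n nothing) (just a)) ⟩
  lookup (single n i a) j                   ≡⟨ e ⟩
  just _                                    ∎) (λ ())
  where open ≡-Reasoning

single-injective : ∀ {A : Set} {n} {i i' : Fin n} {a a' : A} →
                   single n i a ≡ single n i' a' → i ≡ i' × a ≡ a'
single-injective {i = i} {a = a} eq with single-↦⁻ _ _ (subst (_∶ i ↦ a) eq (single-↦ i a))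
... | i≡i' , a'≡a = i≡i' , sym a'≡a

single≢ : ∀ {A : Set} {n} {v : Vec (Maybe A) n} {i j x a} →
          i ≢ j → ∃ (v ∶ i ↦_) → ∃ (v ∶ j ↦_) → v ≢ single n x a
single≢ {x = x} {a} i≢j (_ , vi) (_ , vj) refl =
  i≢j (trans (proj₁ (single-↦⁻ x a vi)) (sym (proj₁ (single-↦⁻ x a vj))))

↦-at : ∀ {A : Set} {n} (v : Vec (Maybe A) n) {i u a b} → v ∶ i ↦ a → i ≡ u → v ∶ u ↦ b → a ≡ b
↦-at v e refl e' = ↦-functional v e e'

partial-≡ : ∀ {A : Set} {n} {v w : Vec (Maybe A) n} →
            (∀ {i a} → v ∶ i ↦ a → lookup v i ≡ lookup w i) →
            (∀ {i b} → w ∶ i ↦ b → ∃ (v ∶ i ↦_)) → v ≡ w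
partial-≡ {v = v} {w} agree w⊆v = begin
  v                  ≡⟨ sym (tabulate∘lookup v) ⟩
  tabulate (lookup v) ≡⟨ tabulate-cong pointwise ⟩
  tabulate (lookup w) ≡⟨ tabulate∘lookup w ⟩
  w                  ∎
  where
    open ≡-Reasoning
    pointwise : ∀ i → lookup v i ≡ lookup w i
    pointwise i with lookup v i in vi
    ... | just a  = trans (sym vi) (agree vi)
    ... | nothing with lookup w i in wi
    ...   | nothing = refl
    ...   | just b  = contradiction (trans (sym vi) (proj₂ (w⊆v wi))) λ ()

∃↦? : ∀ {A : Set} {n} (v : Vec (Maybe A) n) i → Dec (∃ (v ∶ i ↦_))
∃↦? v i = decide (lookup v i) refl
  where
    decide : ∀ m → lookup v i ≡ m → Dec (∃ (v ∶ i ↦_))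
    decide (just a) e = yes (a , e)
    decide nothing  e = no λ (_ , e') → contradiction (trans (sym e) e') λ ()

module _ (G : Graph) where

  adj⇒≢ : ∀ {u v} → adj G u v ≡ true → u ≢ v
  adj⇒≢ {u} a refl = contradiction (trans (sym (irr G u)) a) (λ ())

  walk-crosses : ∀ {S Q : Fin (order G) → Set} → Decidable Q →
                 ∀ {x w} → Walk G S x w → S x → Q x → ¬ Q w →
                 ∃₂ λ u t → S u × S t × Q u × ¬ Q t × adj G u t ≡ true
  walk-crosses Q? here sx qx ¬qw = contradiction qx ¬qw
  walk-crosses Q? {x} (there {w = t} a st walk) sx qx ¬qw with Q? t
  ... | yes qt  = walk-crosses Q? walk st qt ¬qw
  ... | no  ¬qt = x , t , sx , st , qx , ¬qt , a

  walk-leaves : ∀ {S u w} → Walk G S u w → u ≢ w → ∃ λ t → S t × adj G u t ≡ true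
  walk-leaves here           u≢w = contradiction refl u≢w
  walk-leaves (there a st _) _   = _ , st , a

  single-isConnPartialSym : ∀ x y → IsConnPartialSym G (single (order G) x y)
  single-isConnPartialSym x y = (injective , preserves) , (x , y , single-↦ x y) , connected
    where
      injective : ∀ i j k → single _ x y ∶ i ↦ k → single _ x y ∶ j ↦ k → i ≡ j
      injective i j k i↦k j↦k = trans (proj₁ (single-↦⁻ x y i↦k)) (sym (proj₁ (single-↦⁻ x y j↦k)))
      preserves : ∀ i j i' j' → single _ x y ∶ i ↦ i' → single _ x y ∶ j ↦ j' →
                  adj G i j ≡ adj G i' j'
      preserves i j i' j' i↦ j↦ with single-↦⁻ x y i↦ | single-↦⁻ x y j↦
      ... | refl , refl | refl , refl = trans (irr G x) (sym (irr G y))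
      connected : ∀ i j → Dom G (single _ x y) i → Dom G (single _ x y) j → Walk G (Dom G (single _ x y)) i j
      connected i j (_ , i↦) (_ , j↦) with single-↦⁻ x y i↦ | single-↦⁻ x y j↦
      ... | refl , _ | refl , _ = here

-- Partial symmetries of the star

isCentre : ∀ {n} → Fin (suc n) → Bool
isCentre fz     = true
isCentre (fs _) = false

starAdj-xor : ∀ n u v → starAdj n u v ≡ isCentre u xor isCentre v
starAdj-xor n fz     fz     = refl
starAdj-xor n fz     (fs _) = refl
starAdj-xor n (fs _) fz     = refl
starAdj-xor n (fs _) (fs _) = refl

xor-cancelˡ : ∀ b x y → (b xor x) xor (b xor y) ≡ x xor y
xor-cancelˡ false x     y = refl
xor-cancelˡ true  true  y = refl
xor-cancelˡ true  false y = not-involutive y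

module _ {n : ℕ} where

  star-connected : ∀ {S : Fin (suc n) → Set} → S fz → ConnectedOn (Star n) S
  star-connected {S} s₀ = (fz , s₀) , walk
    where
      walk : ∀ i j → S i → S j → Walk (Star n) S i j
      walk fz     fz     _ _  = here
      walk fz     (fs _) _ sj = there refl sj here
      walk (fs _) fz     _ _  = there refl s₀ here
      walk (fs _) (fs _) _ sj = there refl s₀ (there refl sj here)

  star-preserves : (v : PMap (Star n)) (b : Bool) →
                   (∀ {i i'} → v ∶ i ↦ i' → isCentre i' ≡ b xor isCentre i) →
                   ∀ i j i' j' → v ∶ i ↦ i' → v ∶ j ↦ j' → starAdj n i j ≡ starAdj n i' j'
  star-preserves v b class i j i' j' i↦i' j↦j' = begin
    starAdj n i j                              ≡⟨ starAdj-xor n i j ⟩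
    isCentre i xor isCentre j                  ≡⟨ sym (xor-cancelˡ b _ _) ⟩
    (b xor isCentre i) xor (b xor isCentre j)  ≡⟨ sym (cong₂ _xor_ (class i↦i') (class j↦j')) ⟩
    isCentre i' xor isCentre j'                ≡⟨ sym (starAdj-xor n i' j') ⟩
    starAdj n i' j'                            ∎
    where open ≡-Reasoning

  centred : (Fin n → Maybe (Fin n)) → PMap (Star n)
  centred σ = just fz ∷ tabulate (Maybe.map fs ∘ σ)

  centred-leaf : ∀ σ i → lookup (centred σ) (fs i) ≡ Maybe.map fs (σ i)
  centred-leaf σ i = lookup∘tabulate (Maybe.map fs ∘ σ) i

  centred-↦⁻ : ∀ σ {i k} → centred σ ∶ fs i ↦ k → ∃ λ j → σ i ≡ just j × k ≡ fs j
  centred-↦⁻ σ {i} e with σ i | centred-leaf σ i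
  ... | just j | σi = j , refl , sym (just-injective (trans (sym σi) e))
  ... | nothing | σi = contradiction (trans (sym σi) e) (λ ())

  centred-isConnPartialSym : ∀ σ → (∀ {i i' j} → σ i ≡ just j → σ i' ≡ just j → i ≡ i') →
                             IsConnPartialSym (Star n) (centred σ)
  centred-isConnPartialSym σ σ-injective =
    (injective , star-preserves (centred σ) false class) , star-connected (fz , refl)
    where
      injective : ∀ i j k → centred σ ∶ i ↦ k → centred σ ∶ j ↦ k → i ≡ j
      injective fz     fz     _ _    _ = refl
      injective fz     (fs j) _ refl e with centred-↦⁻ σ e
      ... | _ , _ , ()
      injective (fs i) fz     _ e refl with centred-↦⁻ σ e
      ... | _ , _ , ()
      injective (fs i) (fs j) _ e e' with centred-↦⁻ σ e | centred-↦⁻ σ e'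
      ... | _ , σi , refl | _ , σj , refl = cong fs (σ-injective σi σj)
      class : ∀ {i i'} → centred σ ∶ i ↦ i' → isCentre i' ≡ isCentre i
      class {fz}   refl = refl
      class {fs i} e with centred-↦⁻ σ e
      ... | _ , _ , refl = refl

  centred-injective : ∀ σ τ → centred σ ≡ centred τ → ∀ i → σ i ≡ τ i
  centred-injective σ τ eq i = map-injective suc-injective (begin
    Maybe.map fs (σ i)         ≡⟨ sym (centred-leaf σ i) ⟩
    lookup (centred σ) (fs i)  ≡⟨ cong (λ v → lookup v (fs i)) eq ⟩
    lookup (centred τ) (fs i)  ≡⟨ centred-leaf τ i ⟩
    Maybe.map fs (τ i)         ∎)
    where open ≡-Reasoning

  swapped : Fin n → Fin n → PMap (Star n)
  swapped k j = just (fs j) ∷ single n k fz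

  swapped-isConnPartialSym : ∀ k j → IsConnPartialSym (Star n) (swapped k j)
  swapped-isConnPartialSym k j =
    (injective , star-preserves (swapped k j) true class) , star-connected (fs j , refl)
    where
      injective : ∀ i i' t → swapped k j ∶ i ↦ t → swapped k j ∶ i' ↦ t → i ≡ i'
      injective fz     fz      _ _    _ = refl
      injective fz     (fs i') _ refl e with single-↦⁻ k fz e
      ... | _ , ()
      injective (fs i) fz      _ e refl with single-↦⁻ k fz e
      ... | _ , ()
      injective (fs i) (fs i') _ e e' =
        cong fs (trans (proj₁ (single-↦⁻ k fz e)) (sym (proj₁ (single-↦⁻ k fz e'))))
      class : ∀ {i i'} → swapped k j ∶ i ↦ i' → isCentre i' ≡ not (isCentre i)
      class {fz}   refl = refl
      class {fs i} e with single-↦⁻ k fz e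
      ... | _ , refl = refl

  swapped-injective : ∀ {k j k' j'} → swapped k j ≡ swapped k' j' → k ≡ k' × j ≡ j'
  swapped-injective {k} {j} eq =
    proj₁ (single-↦⁻ _ fz (subst (λ v → v ∶ fs k ↦ fz) eq (single-↦ k fz))) ,
    suc-injective (just-injective (cong (λ v → lookup v fz) eq))

  centred≢swapped : ∀ σ {k j} → centred σ ≢ swapped k j
  centred≢swapped _ eq with cong (λ v → lookup v fz) eq
  ... | ()

  fixing : Fin n → Fin n → Fin n → Maybe (Fin n)
  fixing i j t with (t ≟F i) ⊎-dec (t ≟F j)
  ... | yes _ = just t
  ... | no  _ = nothing

  fixing-↦ : ∀ i j {t} → t ≡ i ⊎ t ≡ j → fixing i j t ≡ just t
  fixing-↦ i j {t} t∈ with (t ≟F i) ⊎-dec (t ≟F j)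
  ... | yes _  = refl
  ... | no  t∉ = contradiction t∈ t∉

  fixing-↦⁻ : ∀ i j {t s} → fixing i j t ≡ just s → t ≡ s × (t ≡ i ⊎ t ≡ j)
  fixing-↦⁻ i j {t} e with (t ≟F i) ⊎-dec (t ≟F j)
  fixing-↦⁻ i j refl | yes t∈ = refl , t∈

  fixing-isConnPartialSym : ∀ i j → IsConnPartialSym (Star n) (centred (fixing i j))
  fixing-isConnPartialSym i j =
    centred-isConnPartialSym (fixing i j) λ e e' →
      trans (proj₁ (fixing-↦⁻ i j e)) (sym (proj₁ (fixing-↦⁻ i j e')))


module EdgeIndexed (G : Graph) (es : List (Fin (order G) × Fin (order G))) (es! : Unique es)
               (es-edges : ∀ e → IsEdge G e ⇔ e ∈ es) where

  V : Set
  V = Fin (order G)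

  N : ℕ
  N = length es

  ends : Fin N → V × V
  ends = List.lookup es

  ends-isEdge : ∀ k → IsEdge G (ends k)
  ends-isEdge k = Equivalence.from (es-edges _) (∈-lookup k)

  isEdge⇒ends : ∀ {e} → IsEdge G e → ∃ λ k → ends k ≡ e
  isEdge⇒ends {e} h = index e∈es , sym (lookup-index e∈es)
    where
      e∈es : e ∈ es
      e∈es = Equivalence.to (es-edges e) h

  data Joins (k : Fin N) (u v : V) : Set where
    forward  : ends k ≡ (u , v) → Joins k u v
    backward : ends k ≡ (v , u) → Joins k u v

  joins-ends-of : ∀ k → Joins k (proj₁ (ends k)) (proj₂ (ends k))
  joins-ends-of k = forward refl

  joins-sym : ∀ {k u v} → Joins k u v → Joins k v u
  joins-sym (forward e)  = backward e
  joins-sym (backward e) = forward e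

  joins-adj : ∀ {k u v} → Joins k u v → adj G u v ≡ true
  joins-adj {k} (forward e)  = subst (λ (u , v) → adj G u v ≡ true) e (proj₂ (ends-isEdge k))
  joins-adj {k} {u} {v} (backward e) = trans (Graph.sym G u v) (joins-adj (forward e))

  joins-≢ : ∀ {k u v} → Joins k u v → u ≢ v
  joins-≢ J = adj⇒≢ G (joins-adj J)

  adj⇒joins : ∀ {u v} → adj G u v ≡ true → ∃ λ k → Joins k u v
  adj⇒joins {u} {v} a with <-cmp u v
  ... | tri< u<v _ _ = let k , e = isEdge⇒ends (u<v , a) in k , forward e
  ... | tri≈ _ u≡v _ = contradiction u≡v (adj⇒≢ G a)
  ... | tri> _ _ v<u = let k , e = isEdge⇒ends (v<u , trans (Graph.sym G v u) a) in k , backward e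

  joins-ends : ∀ {k u v u' v'} → Joins k u v → Joins k u' v' → (u ≡ u' × v ≡ v') ⊎ (u ≡ v' × v ≡ u')
  joins-ends (forward e)  (forward e')  = inj₁ (,-injectiveˡ (trans (sym e) e') , ,-injectiveʳ (trans (sym e) e'))
  joins-ends (forward e)  (backward e') = inj₂ (,-injectiveˡ (trans (sym e) e') , ,-injectiveʳ (trans (sym e) e'))
  joins-ends (backward e) (forward e')  = inj₂ (,-injectiveʳ (trans (sym e) e') , ,-injectiveˡ (trans (sym e) e'))
  joins-ends (backward e) (backward e') = inj₁ (,-injectiveʳ (trans (sym e) e') , ,-injectiveˡ (trans (sym e) e'))

  -- Edges are listed with increasing endpoints, so an edge is determined by its endpoints.
  joins-unique : ∀ {k k' u v} → Joins k u v → Joins k' u v → k ≡ k'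
  joins-unique (forward e)  (forward e')  = lookup-injective es! (trans e (sym e'))
  joins-unique (backward e) (backward e') = lookup-injective es! (trans e (sym e'))
  joins-unique {k} {k'} (forward e) (backward e') =
    contradiction (subst (λ (u , v) → toℕ u ℕ.< toℕ v) e (proj₁ (ends-isEdge k)))
                  (<-asym (subst (λ (v , u) → toℕ v ℕ.< toℕ u) e' (proj₁ (ends-isEdge k'))))
  joins-unique (backward e) (forward e') = sym (joins-unique (forward e') (backward e))

  _∈ₑ_ : V → Fin N → Set
  w ∈ₑ k = ∃ (Joins k w)

  _∈ₑ?_ : ∀ w k → Dec (w ∈ₑ k)
  w ∈ₑ? k with w ≟F proj₁ (ends k) | w ≟F proj₂ (ends k)
  ... | yes refl | _        = yes (_ , forward refl)
  ... | no _     | yes refl = yes (_ , backward refl)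
  ... | no w≢a   | no w≢b   = no λ where
    (_ , forward e)  → w≢a (sym (cong proj₁ e))
    (_ , backward e) → w≢b (sym (cong proj₂ e))

  ∈ₑ-joins : ∀ {k u v w} → Joins k u v → w ∈ₑ k → w ≡ u ⊎ w ≡ v
  ∈ₑ-joins J (_ , J') = Sum.map proj₁ proj₁ (joins-ends J' J)

  record Inner (S : V → Set) (k : Fin N) : Set where
    constructor inner
    field
      fst∈ : S (proj₁ (ends k))
      snd∈ : S (proj₂ (ends k))
  open Inner

  inner-∈ₑ : ∀ {S k w} → Inner S k → w ∈ₑ k → S w
  inner-∈ₑ {S} ik (_ , forward e)  = subst S (cong proj₁ e) (fst∈ ik)
  inner-∈ₑ {S} ik (_ , backward e) = subst S (cong proj₂ e) (snd∈ ik)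

  joins⇒inner : ∀ {S k u v} → S u → S v → Joins k u v → Inner S k
  joins⇒inner {S} su sv (forward e)  = inner (subst S (sym (cong proj₁ e)) su) (subst S (sym (cong proj₂ e)) sv)
  joins⇒inner {S} su sv (backward e) = inner (subst S (sym (cong proj₁ e)) sv) (subst S (sym (cong proj₂ e)) su)

  adjacent⇒inner : ∀ {S u t} → S u → S t → adj G u t ≡ true → ∃ λ k → Inner S k × Joins k u t
  adjacent⇒inner su st a = let k , J = adj⇒joins a in k , joins⇒inner su st J , J

  Sole : (V → Set) → Fin N → Set
  Sole S k = Inner S k × ∀ k' → Inner S k' → k' ≡ k

  Two : (V → Set) → Set
  Two S = ∃₂ λ k k' → k ≢ k' × Inner S k × Inner S k'

  two⇒¬sole : ∀ {S k} → Two S → ¬ Sole S k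
  two⇒¬sole (_ , _ , k≢k' , ik , ik') (_ , sole) = k≢k' (trans (sole _ ik) (sym (sole _ ik')))

  inner? : ∀ {S} → Decidable S → ∀ k → Dec (Inner S k)
  inner? S? k = Dec.map′ (λ (s₁ , s₂) → inner s₁ s₂) (λ ik → fst∈ ik , snd∈ ik) (S? _ ×-dec S? _)

  sole-intro : ∀ {S k} → Inner S k → ¬ (∃ λ k' → k' ≢ k × Inner S k') → Sole S k
  sole-intro {k = k} ik alone =
    ik , λ k' ik' → Dec.decidable-stable (k' ≟F k) (λ k'≢k → alone (k' , k'≢k , ik'))

  two-map : ∀ {S T} → (∀ {k} → Inner S k → Inner T k) → Two S → Two T
  two-map S⇒T (k , k' , k≢k' , ik , ik') = k , k' , k≢k' , S⇒T ik , S⇒T ik'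

  two-other : ∀ {S} → Two S → ∀ k → ∃ λ k' → Inner S k' × k' ≢ k
  two-other (k₁ , k₂ , k₁≢k₂ , ik₁ , ik₂) k with k₁ ≟F k
  ... | yes refl = k₂ , ik₂ , λ k₂≡k₁ → k₁≢k₂ (sym k₂≡k₁)
  ... | no k₁≢k  = k₁ , ik₁ , k₁≢k

  module _ {S : V → Set} (S-connected : ConnectedOn G S) where

    private
      walk : ∀ {u w} → S u → S w → Walk G S u w
      walk su sw = proj₂ S-connected _ _ su sw

    inner-covers : ∀ {k₀ w} → Inner S k₀ → S w → ∃ λ k → Inner S k × w ∈ₑ k
    inner-covers {k₀} {w} ik₀ sw with w ≟F proj₁ (ends k₀)
    ... | yes refl = k₀ , ik₀ , _ , forward refl
    ... | no  w≢a  with walk-leaves G (walk sw (fst∈ ik₀)) w≢a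
    ... | t , st , a with adjacent⇒inner sw st a
    ... | k , ik , J = k , ik , _ , J

    no-inner⇒subsingleton : (∀ k → ¬ Inner S k) → ∀ {u w} → S u → S w → u ≡ w
    no-inner⇒subsingleton none {u} {w} su sw with u ≟F w
    ... | yes u≡w = u≡w
    ... | no  u≢w with walk-leaves G (walk su sw) u≢w
    ... | t , st , a = contradiction (proj₁ (proj₂ (adjacent⇒inner su st a))) (none _)

    inner-touches : ∀ {k k'} → Inner S k → Inner S k' → k' ≢ k →
                    ∃ λ k'' → k'' ≢ k × Inner S k'' × ∃ λ z → z ∈ₑ k × z ∈ₑ k''
    inner-touches {k} {k'} ik ik' k'≢k with proj₁ (ends k') ∈ₑ? k
    ... | yes a'∈k = k' , k'≢k , ik' , _ , a'∈k , _ , forward refl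
    ... | no  a'∉k
      with walk-crosses G (_∈ₑ? k) (walk (fst∈ ik) (fst∈ ik')) (fst∈ ik) (_ , forward refl) a'∉k
    ... | u , t , su , st , u∈k , t∉k , a with adjacent⇒inner su st a
    ... | k'' , ik'' , J = k'' , (λ { refl → t∉k (_ , joins-sym J) }) , ik'' , u , u∈k , _ , J

    sole-covers : ∀ {k w} → Sole S k → S w → w ∈ₑ k
    sole-covers {w = w} (ik , sole) sw with inner-covers ik sw
    ... | k' , ik' , w∈k' = subst (w ∈ₑ_) (sole k' ik') w∈k'

  Preserves Reverses : PMap G → Fin N → Fin N → Set
  Preserves p k j = p ∶ proj₁ (ends k) ↦ proj₁ (ends j) × p ∶ proj₂ (ends k) ↦ proj₂ (ends j)
  Reverses  p k j = p ∶ proj₁ (ends k) ↦ proj₂ (ends j) × p ∶ proj₂ (ends k) ↦ proj₁ (ends j)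

  data SendsEdge (p : PMap G) (k j : Fin N) : Set where
    preserving : Preserves p k j → SendsEdge p k j
    reversing  : Reverses p k j → SendsEdge p k j

  sendsEdge? : ∀ p k j → Dec (SendsEdge p k j)
  sendsEdge? p k j =
    Dec.map′ Sum.[ preserving , reversing ] (λ { (preserving x) → inj₁ x ; (reversing x) → inj₂ x })
             (((_ ≟ _) ×-dec (_ ≟ _)) ⊎-dec ((_ ≟ _) ×-dec (_ ≟ _)))
    where
      _≟_ : DecidableEquality (Maybe V)
      _≟_ = ≡-decMaybe _≟F_

  sendsEdge-inner : ∀ {p k j} → SendsEdge p k j → Inner (Dom G p) k
  sendsEdge-inner (preserving (e₁ , e₂)) = inner (_ , e₁) (_ , e₂)
  sendsEdge-inner (reversing  (e₁ , e₂)) = inner (_ , e₁) (_ , e₂)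

  sendsEdge-joins : ∀ {p k j u v u' v'} → SendsEdge p k j → Joins k u v →
                    p ∶ u ↦ u' → p ∶ v ↦ v' → Joins j u' v'
  sendsEdge-joins {p} (preserving (e₁ , e₂)) (forward e) pu pv =
    forward (cong₂ _,_ (↦-at p e₁ (cong proj₁ e) pu) (↦-at p e₂ (cong proj₂ e) pv))
  sendsEdge-joins {p} (preserving (e₁ , e₂)) (backward e) pu pv =
    backward (cong₂ _,_ (↦-at p e₁ (cong proj₁ e) pv) (↦-at p e₂ (cong proj₂ e) pu))
  sendsEdge-joins {p} (reversing (e₁ , e₂)) (forward e) pu pv =
    backward (cong₂ _,_ (↦-at p e₂ (cong proj₂ e) pv) (↦-at p e₁ (cong proj₁ e) pu))
  sendsEdge-joins {p} (reversing (e₁ , e₂)) (backward e) pu pv =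
    forward (cong₂ _,_ (↦-at p e₂ (cong proj₂ e) pu) (↦-at p e₁ (cong proj₁ e) pv))

  joins⇒sendsEdge : ∀ {p k j a b} → p ∶ proj₁ (ends k) ↦ a → p ∶ proj₂ (ends k) ↦ b → Joins j a b →
                    SendsEdge p k j
  joins⇒sendsEdge {p} {k} pa pb (forward e) =
    preserving (subst (λ (x , y) → p ∶ proj₁ (ends k) ↦ x × p ∶ proj₂ (ends k) ↦ y) (sym e) (pa , pb))
  joins⇒sendsEdge {p} {k} pa pb (backward e) =
    reversing (subst (λ (y , x) → p ∶ proj₁ (ends k) ↦ x × p ∶ proj₂ (ends k) ↦ y) (sym e) (pa , pb))

  module _ {p : PMap G} (p-sym : IsPartialSym G p) where

    private
      injective : ∀ {u v a} → p ∶ u ↦ a → p ∶ v ↦ a → u ≡ v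
      injective = proj₁ p-sym _ _ _

    inner⇒sendsEdge : ∀ {k} → Inner (Dom G p) k → ∃ (SendsEdge p k)
    inner⇒sendsEdge {k} (inner (a , pa) (b , pb)) =
      let j , J = adj⇒joins (trans (sym (proj₂ p-sym _ _ _ _ pa pb)) (proj₂ (ends-isEdge k)))
      in j , joins⇒sendsEdge pa pb J

    inner-transfer : ∀ {q} → (∀ {k j} → SendsEdge p k j → SendsEdge q k j) →
                     ∀ {k} → Inner (Dom G p) k → Inner (Dom G q) k
    inner-transfer p→q ik = sendsEdge-inner (p→q (proj₂ (inner⇒sendsEdge ik)))

    sendsEdge-functional : ∀ {k j j'} → SendsEdge p k j → SendsEdge p k j' → j ≡ j'
    sendsEdge-functional s s' with sendsEdge-inner s
    ... | inner (_ , pa) (_ , pb) =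
      joins-unique (sendsEdge-joins s (forward refl) pa pb) (sendsEdge-joins s' (forward refl) pa pb)

    sendsEdge-injective : ∀ {k k' j} → SendsEdge p k j → SendsEdge p k' j → k ≡ k'
    sendsEdge-injective {k} {k'} s s' with sendsEdge-inner s | sendsEdge-inner s'
    ... | inner (_ , pa) (_ , pb) | inner (_ , pc) (_ , pd)
      with joins-ends (sendsEdge-joins s (forward refl) pa pb) (sendsEdge-joins s' (forward refl) pc pd)
    ... | inj₁ (refl , refl) =
      joins-unique (joins-ends-of k) (forward (cong₂ _,_ (sym (injective pa pc)) (sym (injective pb pd))))
    ... | inj₂ (refl , refl) =
      joins-unique (joins-ends-of k) (backward (cong₂ _,_ (sym (injective pb pc)) (sym (injective pa pd))))

  edgeImage : PMap G → Fin N → Maybe (Fin N)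
  edgeImage p k with any? (sendsEdge? p k)
  ... | yes (j , _) = just j
  ... | no _        = nothing

  edgeImage-sound : ∀ {p k j} → edgeImage p k ≡ just j → SendsEdge p k j
  edgeImage-sound {p} {k} e with any? (sendsEdge? p k)
  edgeImage-sound refl | yes (_ , s) = s

  edgeImage-complete : ∀ {p k j} → IsPartialSym G p → SendsEdge p k j → edgeImage p k ≡ just j
  edgeImage-complete {p} {k} p-sym s with any? (sendsEdge? p k)
  ... | yes (_ , s') = cong just (sendsEdge-functional p-sym s' s)
  ... | no none      = contradiction (_ , s) none

  Aligned : PMap G → Set
  Aligned p = Two (Dom G p) ⊎ ∃₂ λ k j → Sole (Dom G p) k × Preserves p k j

  aligned-inner : ∀ {p} → Aligned p → ∃ (Inner (Dom G p))
  aligned-inner (inj₁ (k , _ , _ , ik , _)) = k , ik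
  aligned-inner (inj₂ (k , _ , (ik , _) , _)) = k , ik

  -- Connected partial symmetries are determined by their action on edges

  module Determination {p q : PMap G} (p-cps : IsConnPartialSym G p) (q-cps : IsConnPartialSym G q) where

    private
      q-injective : ∀ {u v a} → q ∶ u ↦ a → q ∶ v ↦ a → u ≡ v
      q-injective = proj₁ (proj₁ q-cps) _ _ _

    isolated-determined : (∀ k → ¬ Inner (Dom G p) k) → (∀ k → ¬ Inner (Dom G q) k) →
                          ∀ {u v} → p ∶ u ↦ v → q ∶ u ↦ v → p ≡ q
    isolated-determined p-none q-none pu qu = partial-≡ agree included
      where
        agree : ∀ {w a} → p ∶ w ↦ a → lookup p w ≡ lookup q w
        agree pw with no-inner⇒subsingleton (proj₂ p-cps) p-none (_ , pw) (_ , pu)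
        ... | refl = trans pu (sym qu)
        included : ∀ {w b} → q ∶ w ↦ b → Dom G p w
        included qw with no-inner⇒subsingleton (proj₂ q-cps) q-none (_ , qw) (_ , qu)
        ... | refl = _ , pu

    sole-determined : ∀ {k} → Sole (Dom G p) k → Sole (Dom G q) k →
                      lookup p (proj₁ (ends k)) ≡ lookup q (proj₁ (ends k)) →
                      lookup p (proj₂ (ends k)) ≡ lookup q (proj₂ (ends k)) → p ≡ q
    sole-determined {k} p-sole q-sole e₁ e₂ = partial-≡ agree included
      where
        agree : ∀ {w a} → p ∶ w ↦ a → lookup p w ≡ lookup q w
        agree pw with ∈ₑ-joins (joins-ends-of k) (sole-covers (proj₂ p-cps) p-sole (_ , pw))
        ... | inj₁ refl = e₁
        ... | inj₂ refl = e₂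
        included : ∀ {w b} → q ∶ w ↦ b → Dom G p w
        included qw = inner-∈ₑ (proj₁ p-sole) (sole-covers (proj₂ q-cps) q-sole (_ , qw))

    module _ (p→q : ∀ {k j} → SendsEdge p k j → SendsEdge q k j) where

      private
        values : ∀ {k z x} → Inner (Dom G p) k → Joins k z x →
                 Dom G p z × Dom G p x × Dom G q z × Dom G q x
        values ik J =
          let ik' = inner-transfer (proj₁ p-cps) p→q ik
          in  inner-∈ₑ ik (_ , J) , inner-∈ₑ ik (_ , joins-sym J) ,
              inner-∈ₑ ik' (_ , J) , inner-∈ₑ ik' (_ , joins-sym J)

      same-image-ends : ∀ {k z x a b c d} → Inner (Dom G p) k → Joins k z x →
                        p ∶ z ↦ a → p ∶ x ↦ b → q ∶ z ↦ c → q ∶ x ↦ d →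
                        (a ≡ c × b ≡ d) ⊎ (a ≡ d × b ≡ c)
      same-image-ends ik J pz px qz qx =
        let _ , s = inner⇒sendsEdge (proj₁ p-cps) ik
        in joins-ends (sendsEdge-joins s J pz px) (sendsEdge-joins (p→q s) J qz qx)

      -- p z and q z agree unless q swaps the ends of both edges, which would identify x and y.
      agree-at-junction : ∀ {k k' z x y} → Inner (Dom G p) k → Inner (Dom G p) k' →
                          Joins k z x → Joins k' z y → x ≢ y → lookup p z ≡ lookup q z
      agree-at-junction ik ik' J J' x≢y with values ik J | values ik' J'
      ... | (_ , pz) , (_ , px) , (_ , qz) , (_ , qx) | _ , (_ , py) , _ , (_ , qy)
        with same-image-ends ik J pz px qz qx | same-image-ends ik' J' pz py qz qy
      ... | inj₁ (refl , _) | _               = trans pz (sym qz)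
      ... | inj₂ _          | inj₁ (refl , _) = trans pz (sym qz)
      ... | inj₂ (refl , _) | inj₂ (refl , _) = contradiction (q-injective qx qy) x≢y

      agree-along-edge : ∀ {k z x} → Inner (Dom G p) k → Joins k z x →
                         lookup p z ≡ lookup q z → lookup p x ≡ lookup q x
      agree-along-edge ik J pz≡qz with values ik J
      ... | (_ , pz) , (_ , px) , (_ , qz) , (_ , qx) with same-image-ends ik J pz px qz qx
      ... | inj₁ (_ , refl)    = trans px (sym qx)
      ... | inj₂ (refl , refl) =
        contradiction (q-injective qz (subst (q ∶ _ ↦_) (↦-functional q (trans (sym pz≡qz) pz) qz) qx)) (joins-≢ J)

      two-agree : Two (Dom G p) → ∀ {w a} → p ∶ w ↦ a → lookup p w ≡ lookup q w
      two-agree two@(_ , _ , _ , ik₁ , _) pw with inner-covers (proj₂ p-cps) ik₁ (_ , pw)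
      ... | k , ik , w∈k with two-other two k
      ... | k' , ik' , k'≢k with inner-touches (proj₂ p-cps) ik ik' k'≢k
      ... | k'' , k''≢k , ik'' , z , (x , J) , (y , J'')
        with agree-at-junction ik ik'' J J'' (λ { refl → k''≢k (joins-unique J'' J) })
      ... | pz≡qz with ∈ₑ-joins J w∈k
      ... | inj₁ refl = pz≡qz
      ... | inj₂ refl = agree-along-edge ik J pz≡qz

    two-determined : (∀ {k j} → SendsEdge p k j → SendsEdge q k j) →
                     (∀ {k j} → SendsEdge q k j → SendsEdge p k j) →
                     Two (Dom G p) → p ≡ q
    two-determined p→q q→p two@(_ , _ , _ , ik₁ , _) = partial-≡ (two-agree p→q two) included
      where
        included : ∀ {w b} → q ∶ w ↦ b → Dom G p w
        included qw with inner-covers (proj₂ q-cps) (inner-transfer (proj₁ p-cps) p→q ik₁) (_ , qw)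
        ... | k , ik , w∈k = inner-∈ₑ (inner-transfer (proj₁ q-cps) q→p ik) w∈k

    aligned-determined : Aligned p → Aligned q → (∀ k → edgeImage p k ≡ edgeImage q k) → p ≡ q
    aligned-determined p-aligned q-aligned images = go p-aligned q-aligned
      where
        p→q : ∀ {k j} → SendsEdge p k j → SendsEdge q k j
        p→q {k} s = edgeImage-sound (trans (sym (images k)) (edgeImage-complete (proj₁ p-cps) s))
        q→p : ∀ {k j} → SendsEdge q k j → SendsEdge p k j
        q→p {k} s = edgeImage-sound (trans (images k) (edgeImage-complete (proj₁ q-cps) s))
        go : Aligned p → Aligned q → p ≡ q
        go (inj₁ two) _ = two-determined p→q q→p two
        go (inj₂ (_ , _ , p-sole , _)) (inj₁ two) =
          contradiction p-sole (two⇒¬sole (two-map (inner-transfer (proj₁ q-cps) q→p) two))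
        go (inj₂ (k , j , p-sole , pk↦j)) (inj₂ (k' , j' , q-sole , qk'↦j'))
          with proj₂ p-sole k' (inner-transfer (proj₁ q-cps) q→p (proj₁ q-sole))
        ... | refl with sendsEdge-functional (proj₁ q-cps) (p→q (preserving pk↦j)) (preserving qk'↦j')
        ... | refl = sole-determined p-sole q-sole (trans (proj₁ pk↦j) (sym (proj₁ qk'↦j')))
                                                   (trans (proj₂ pk↦j) (sym (proj₂ qk'↦j')))

  data Shape (p : PMap G) : Set where
    isolated : ∀ u v → p ∶ u ↦ v → (∀ k → ¬ Inner (Dom G p) k) → Shape p
    reversed : ∀ k j → Sole (Dom G p) k → Reverses p k j → Shape p
    aligned  : Aligned p → Shape p

  shape : ∀ {p} → IsConnPartialSym G p → Shape p
  shape {p} p-cps with any? (inner? (∃↦? p))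
  ... | no none = let u , v , pu = proj₁ (proj₂ p-cps) in isolated u v pu (λ k ik → none (k , ik))
  ... | yes (k , ik) with any? (λ k' → ¬? (k' ≟F k) ×-dec inner? (∃↦? p) k')
  ... | yes (k' , k'≢k , ik') = aligned (inj₁ (k' , k , k'≢k , ik' , ik))
  ... | no alone with inner⇒sendsEdge {p} (proj₁ p-cps) ik
  ... | j , preserving pk↦j = aligned (inj₂ (k , j , sole-intro ik alone , pk↦j))
  ... | j , reversing  pk↦j = reversed k j (sole-intro ik alone) pk↦j

  -- The embedding into the star

  module _ (G-connected : Connected G) where

    private
      root : V
      root = proj₁ (proj₁ G-connected)

    record Subtree (k : ℕ) : Set where
      field
        vertices   : List V
        edges      : List (Fin N)
        vertices!  : Unique vertices
        edges!     : Unique edges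
        |vertices| : length vertices ≡ suc k
        |edges|    : length edges ≡ k
        root∈      : root ∈ vertices
        edges⊆     : ∀ {e w} → e ∈ edges → w ∈ₑ e → w ∈ vertices

    subtree-≤ : ∀ {k} → Subtree k → k ≤ N
    subtree-≤ T = subst (_≤ N) |edges| (injective⇒≤ (lookup-injective edges!))
      where open Subtree T

    grow : ∀ k → k ℕ.< order G → Subtree k
    grow zero _ = record
      { vertices = root ∷ [] ; edges = [] ; vertices! = [] ∷ [] ; edges! = []
      ; |vertices| = refl ; |edges| = refl ; root∈ = here refl ; edges⊆ = λ () }
    grow (suc k) k<n with grow k (<-trans (n<1+n k) k<n)
    ... | T with length<⇒∃∉ (Subtree.vertices T) (subst (ℕ._< order G) (sym (Subtree.|vertices| T)) k<n)
    ... | w , w∉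
      with walk-crosses G (_∈? Subtree.vertices T) (proj₂ G-connected root w tt tt) tt (Subtree.root∈ T) w∉
    ... | u , t , _ , _ , u∈ , t∉ , a with adj⇒joins a
    ... | e , J = record
      { vertices = t ∷ vertices ; edges = e ∷ edges
      ; vertices! = ¬Any⇒All¬ vertices t∉ ∷ vertices!
      ; edges! = ¬Any⇒All¬ edges (λ e∈ → t∉ (edges⊆ e∈ (_ , joins-sym J))) ∷ edges!
      ; |vertices| = cong suc |vertices| ; |edges| = cong suc |edges|
      ; root∈ = there root∈
      ; edges⊆ = λ where
          (here refl) w∈e → Sum.[ (λ { refl → there u∈ }) , (λ { refl → here refl }) ] (∈ₑ-joins J w∈e)
          (there e∈)  w∈e → there (edges⊆ e∈ w∈e) }
      where open Subtree T

    order≤suc-size : order G ≤ suc N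
    order≤suc-size = below-bounded⇒≤suc root λ k k<n → subtree-≤ (grow k k<n)

  InducedCherry : Fin N → Fin N → Set
  InducedCherry i j = ∃ λ z → ∃₂ λ x y → Joins i z x × Joins j z y × adj G x y ≡ false

  closing-edge-new : ∀ {i j k z x y} → Joins i z x → Joins j z y → Joins k x y → k ≢ i
  closing-edge-new Ji Jj Jk refl with joins-ends Jk Ji
  ... | inj₁ (x≡z , _) = joins-≢ Ji (sym x≡z)
  ... | inj₂ (_ , y≡z) = joins-≢ Jj (sym y≡z)

  module Embedding (order≤ : order G ≤ suc N) where

    ι : V → Fin (suc N)
    ι v = inject≤ v order≤

    φ : ∀ p → Shape p → PMap (Star N)
    φ p (isolated u v _ _) = single (suc N) (ι u) (ι v)
    φ p (reversed k j _ _) = swapped k j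
    φ p (aligned _)        = centred (edgeImage p)

    φ-isConnPartialSym : ∀ {p} → IsPartialSym G p → (s : Shape p) → IsConnPartialSym (Star N) (φ p s)
    φ-isConnPartialSym _ (isolated u v _ _) = single-isConnPartialSym (Star N) (ι u) (ι v)
    φ-isConnPartialSym _ (reversed k j _ _) = swapped-isConnPartialSym k j
    φ-isConnPartialSym p-sym (aligned _)    =
      centred-isConnPartialSym _ λ e e' → sendsEdge-injective p-sym (edgeImage-sound e) (edgeImage-sound e')

    centred-leaf-of-aligned : ∀ {p} → IsPartialSym G p → Aligned p →
                              ∃ λ k → Dom (Star N) (centred (edgeImage p)) (fs k)
    centred-leaf-of-aligned {p} p-sym p-aligned =
      let k , ik = aligned-inner {p} p-aligned
          _ , s  = inner⇒sendsEdge {p} p-sym ik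
      in k , _ , trans (centred-leaf (edgeImage p) k) (cong (Maybe.map fs) (edgeImage-complete {p} p-sym s))

    φ-injective : ∀ {p q} → IsConnPartialSym G p → IsConnPartialSym G q →
                  (s : Shape p) (t : Shape q) → φ p s ≡ φ q t → p ≡ q
    φ-injective p-cps q-cps (isolated _ _ pu p-none) (isolated _ _ qu q-none) eq
      with single-injective eq
    ... | ιu≡ιu' , ιv≡ιv'
      with inject≤-injective order≤ order≤ _ _ ιu≡ιu' | inject≤-injective order≤ order≤ _ _ ιv≡ιv'
    ... | refl | refl = Determination.isolated-determined p-cps q-cps p-none q-none pu qu
    φ-injective _ _ (isolated _ _ _ _) (reversed k _ _ _) eq =
      contradiction (sym eq) (single≢ {i = fz} {fs k} (λ ()) (_ , refl) (_ , single-↦ k fz))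
    φ-injective _ q-cps (isolated _ _ _ _) (aligned q-aligned) eq =
      let k , leaf = centred-leaf-of-aligned (proj₁ q-cps) q-aligned
      in contradiction (sym eq) (single≢ {i = fz} {fs k} (λ ()) (_ , refl) leaf)
    φ-injective _ _ (reversed k _ _ _) (isolated _ _ _ _) eq =
      contradiction eq (single≢ {i = fz} {fs k} (λ ()) (_ , refl) (_ , single-↦ k fz))
    φ-injective p-cps _ (aligned p-aligned) (isolated _ _ _ _) eq =
      let k , leaf = centred-leaf-of-aligned (proj₁ p-cps) p-aligned
      in contradiction eq (single≢ {i = fz} {fs k} (λ ()) (_ , refl) leaf)
    φ-injective p-cps q-cps (reversed _ _ p-sole pk↦j) (reversed _ _ q-sole qk↦j) eq
      with swapped-injective eq
    ... | refl , refl = Determination.sole-determined p-cps q-cps p-sole q-sole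
                          (trans (proj₁ pk↦j) (sym (proj₁ qk↦j))) (trans (proj₂ pk↦j) (sym (proj₂ qk↦j)))
    φ-injective {q = q} _ _ (reversed _ _ _ _) (aligned _) eq =
      contradiction (sym eq) (centred≢swapped (edgeImage q))
    φ-injective {p} _ _ (aligned _) (reversed _ _ _ _) eq =
      contradiction eq (centred≢swapped (edgeImage p))
    φ-injective {p} {q} p-cps q-cps (aligned p-aligned) (aligned q-aligned) eq =
      Determination.aligned-determined p-cps q-cps p-aligned q-aligned
        (centred-injective (edgeImage p) (edgeImage q) eq)

    module PreimageOfFixing {i j p} (i≢j : i ≢ j) (p-cps : IsConnPartialSym G p)
                            (eq : centred (edgeImage p) ≡ centred (fixing i j)) where

      private
        images : ∀ t → edgeImage p t ≡ fixing i j t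
        images = centred-injective (edgeImage p) (fixing i j) eq

        fixed-inner : ∀ {t} → t ≡ i ⊎ t ≡ j → Inner (Dom G p) t
        fixed-inner {t} t∈ = sendsEdge-inner (edgeImage-sound {p} (trans (images t) (fixing-↦ i j t∈)))

        inner-fixed : ∀ {t} → Inner (Dom G p) t → t ≡ i ⊎ t ≡ j
        inner-fixed {t} it =
          let _ , s = inner⇒sendsEdge {p} (proj₁ p-cps) it
          in proj₂ (fixing-↦⁻ i j (trans (sym (images t)) (edgeImage-complete {p} (proj₁ p-cps) s)))

      cherry : InducedCherry i j
      cherry
        with inner-touches (proj₂ p-cps) (fixed-inner (inj₁ refl)) (fixed-inner (inj₂ refl)) (λ j≡i → i≢j (sym j≡i))
      ... | k , k≢i , ik , z , (x , Ji) , (y , Jk) with inner-fixed ik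
      ... | inj₁ k≡i = contradiction k≡i k≢i
      ... | inj₂ refl with adj G x y in xy
      ... | false = z , x , y , Ji , Jk , xy
      ... | true with adjacent⇒inner {Dom G p} (inner-∈ₑ (fixed-inner (inj₁ refl)) (z , joins-sym Ji))
                                              (inner-∈ₑ ik (z , joins-sym Jk)) xy
      ... | k' , ik' , Jxy with inner-fixed ik'
      ... | inj₁ refl = contradiction refl (closing-edge-new Ji Jk Jxy)
      ... | inj₂ refl = contradiction refl (closing-edge-new Jk Ji (joins-sym Jxy))

    hit⇒cherry : ∀ {i j p} → i ≢ j → IsConnPartialSym G p → (s : Shape p) → φ p s ≡ centred (fixing i j) →
                 InducedCherry i j
    hit⇒cherry {i} {j} _ _ (isolated _ _ _ _) eq =
      contradiction (sym eq) (single≢ {i = fz} {fs i} (λ ()) (_ , refl) (_ , leaf-i))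
      where
        leaf-i : centred (fixing i j) ∶ fs i ↦ fs i
        leaf-i = trans (centred-leaf (fixing i j) i) (cong (Maybe.map fs) (fixing-↦ i j (inj₁ refl)))
    hit⇒cherry {i} {j} _ _ (reversed _ _ _ _) eq = contradiction (sym eq) (centred≢swapped (fixing i j))
    hit⇒cherry i≢j p-cps (aligned _) eq = PreimageOfFixing.cherry i≢j p-cps eq

    embed : ∀ p → IsConnPartialSym G p → PMap (Star N)
    embed p p-cps = φ p (shape p-cps)

    embed-isConnPartialSym : ∀ {p} (p-cps : IsConnPartialSym G p) → IsConnPartialSym (Star N) (embed p p-cps)
    embed-isConnPartialSym p-cps = φ-isConnPartialSym (proj₁ p-cps) (shape p-cps)

    embed-injective : ∀ {p q} (p-cps : IsConnPartialSym G p) (q-cps : IsConnPartialSym G q) →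
                      embed p p-cps ≡ embed q q-cps → p ≡ q
    embed-injective p-cps q-cps = φ-injective p-cps q-cps (shape p-cps) (shape q-cps)

    equal-count⇒cherries : ∀ {a} → Copsi G a → Copsi (Star N) a → ∀ {i j} → i ≢ j → InducedCherry i j
    equal-count⇒cherries count-G count-Star {i} {j} i≢j =
      let p , p-cps , hit = count-injective⇒onto embed embed-isConnPartialSym embed-injective
                              count-G count-Star (fixing-isConnPartialSym i j)
      in hit⇒cherry i≢j p-cps (shape p-cps) hit

  -- The extremal case

  cherry-meets : ∀ {i j} → InducedCherry i j → ∃ λ z → z ∈ₑ i × z ∈ₑ j
  cherry-meets (z , x , y , Ji , Jj , _) = z , (x , Ji) , (y , Jj)

  module _ (cherry : ∀ {i j} → i ≢ j → InducedCherry i j) where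

    meets-at-other-end : ∀ {k₀ k a b} → Joins k₀ a b → ¬ a ∈ₑ k → b ∈ₑ k
    meets-at-other-end {k₀} {k} J a∉k with cherry-meets (cherry {k₀} {k} (λ { refl → a∉k (_ , J) }))
    ... | z , z∈k₀ , z∈k with ∈ₑ-joins J z∈k₀
    ... | inj₁ refl = contradiction z∈k a∉k
    ... | inj₂ refl = z∈k

    cherries⇒centre : V → ∃ λ c → ∀ k → c ∈ₑ k
    cherries⇒centre v with all? (v ∈ₑ?_)
    ... | yes v-centre = v , v-centre
    ... | no ¬v-centre with ¬∀⟶∃¬ N _ (v ∈ₑ?_) ¬v-centre
    ... | k₀ , _ with all? (proj₁ (ends k₀) ∈ₑ?_) | all? (proj₂ (ends k₀) ∈ₑ?_)
    ... | yes a-centre | _            = _ , a-centre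
    ... | no _         | yes b-centre = _ , b-centre
    ... | no ¬a-centre | no ¬b-centre
      -- Edges k₁ ∌ a and k₂ ∌ b would form an induced cherry with outer ends a and b, yet ab is an edge.
      with ¬∀⟶∃¬ N _ (proj₁ (ends k₀) ∈ₑ?_) ¬a-centre | ¬∀⟶∃¬ N _ (proj₂ (ends k₀) ∈ₑ?_) ¬b-centre
    ... | k₁ , a∉k₁ | k₂ , b∉k₂
      with meets-at-other-end (joins-ends-of k₀) a∉k₁
         | meets-at-other-end (joins-sym (joins-ends-of k₀)) b∉k₂
    ... | b∈k₁ | a∈k₂ with cherry {k₁} {k₂} (λ { refl → b∉k₂ b∈k₁ })
    ... | z , x , y , J₁ , J₂ , xy≡false with ∈ₑ-joins J₁ b∈k₁ | ∈ₑ-joins J₂ a∈k₂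
    ... | inj₁ refl | _         = contradiction (_ , J₂) b∉k₂
    ... | _         | inj₁ refl = contradiction (_ , J₁) a∉k₁
    ... | inj₂ refl | inj₂ refl =
      contradiction (trans (sym xy≡false) (joins-adj (joins-sym (joins-ends-of k₀)))) λ ()

  joins-other-end : ∀ {k c x v} → Joins k c x → Joins k c v → x ≡ v
  joins-other-end J J' with joins-ends J J'
  ... | inj₁ (_ , x≡v)   = x≡v
  ... | inj₂ (c≡v , x≡c) = trans x≡c c≡v

  module _ (G-connected : Connected G) {c : V} (centre : ∀ k → c ∈ₑ k) where

    private
      adj-centre : ∀ {u v} → adj G u v ≡ true → u ≡ c ⊎ v ≡ c
      adj-centre a = let k , J = adj⇒joins a in Sum.map sym sym (∈ₑ-joins J (centre k))

      spoke : ∀ {v} → v ≢ c → ∃ λ k → Joins k c v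
      spoke {v} v≢c with walk-leaves G (proj₂ G-connected v c tt tt) v≢c
      ... | t , _ , a with adj-centre a
      ... | inj₁ v≡c  = contradiction v≡c v≢c
      ... | inj₂ refl = let k , J = adj⇒joins a in k , joins-sym J

      to : V → Fin (suc N)
      to v with v ≟F c
      ... | yes _   = fz
      ... | no  v≢c = fs (proj₁ (spoke v≢c))

      from : Fin (suc N) → V
      from fz     = c
      from (fs k) = proj₁ (centre k)

      from-to : ∀ v → from (to v) ≡ v
      from-to v with v ≟F c
      ... | yes refl = refl
      ... | no  v≢c  = let k , J = spoke v≢c in joins-other-end (proj₂ (centre k)) J

      to-from : ∀ y → to (from y) ≡ y
      to-from fz with c ≟F c
      ... | yes _   = refl
      ... | no  c≢c = contradiction refl c≢c
      to-from (fs k) with proj₁ (centre k) ≟F c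
      ... | yes x≡c = contradiction (sym x≡c) (joins-≢ (proj₂ (centre k)))
      ... | no  x≢c = cong fs (joins-unique (proj₂ (spoke x≢c)) (proj₂ (centre k)))

      adj-to : ∀ u v → adj G u v ≡ starAdj N (to u) (to v)
      adj-to u v with u ≟F c | v ≟F c
      ... | yes refl | yes refl = irr G c
      ... | yes refl | no  v≢c  = joins-adj (proj₂ (spoke v≢c))
      ... | no  u≢c  | yes refl = joins-adj (joins-sym (proj₂ (spoke u≢c)))
      ... | no  u≢c  | no  v≢c  with adj G u v in uv
      ... | false = refl
      ... | true with adj-centre uv
      ... | inj₁ u≡c = contradiction u≡c u≢c
      ... | inj₂ v≡c = contradiction v≡c v≢c

    centre⇒≅Star : G ≅ Star N
    centre⇒≅Star = mk↔ₛ′ to from to-from from-to , adj-to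

theorem1 : (n : ℕ) (G : Graph) → Connected G → HasSize G n →
    (∀ a b → Copsi G a → Copsi (Star n) b → a ≤ b) ×
    (∀ a → Copsi G a → Copsi (Star n) a → G ≅ Star n)
theorem1 .(length es) G G-connected (es , refl , es! , es-edges) = bound , extremal
  where
    open EdgeIndexed G es es! es-edges
    open Embedding (order≤suc-size G-connected)

    bound : ∀ a b → Copsi G a → Copsi (Star N) b → a ≤ b
    bound _ _ = count-injective⇒≤ embed embed-isConnPartialSym embed-injective

    extremal : ∀ a → Copsi G a → Copsi (Star N) a → G ≅ Star N
    extremal _ count-G count-Star =
      let _ , centre = cherries⇒centre (equal-count⇒cherries count-G count-Star) (proj₁ (proj₁ G-connected))
      in centre⇒≅Star G-connected centre
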